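{- Let $m=k+t+s+1$ where $s\ge 1$, $k\ge 1$, $t\ge 3$ are integers, let $x_1,y_1\in\{0,1\}^k$, $x_2,y_2\in\{0,1\}^t$, $x_3,y_3\in\{0,1\}^s$ and $\alpha\in\{0,1\}$. Suppose $$A=(a_{ij})=\begin{bmatrix} 0&J_{k,t}&J_{k,s}&x_1\\ 0&T_t&J_{t,s}&x_2\\ 0&0&0&x_3\\ y_1^T&y_2^T&y_3^T&\alpha\end{bmatrix}\in\Gamma(m,t+1)$$ and $$\sum_{i=1}^3\big[f(x_i)+f(y_i)\big]+\alpha\ge s+k+2.$$ Then $\alpha=0$, $y_1=0$, $x_3=0$, and $a_{im}a_{mj}=0$ for all $1\le i,j\le m$ with $j\le i+2$.
   Context: $J_{a,b}$ is the $a\times b$ all-ones matrix; $T_t$ is the $t\times t$ matrix with $(i,j)$-entry $1$ if $i<j$ and $0$ otherwise; the blocks written $0$ are zero matrices of the appropriate sizes. For a $0$-$1$ matrix or vector $B$, $f(B)$ is the number of entries equal to $1$. $\Gamma(n,k)$ is the set of $n\times n$ $0$-$1$ matrices $A$ such that every entry of the (integer) matrix power $A^k$ is $0$ or $1$. -}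

module Defs where

open import Data.Nat using (ℕ; zero; suc; _+_; _*_; _≤_; _<?_)
open import Data.Bool using (Bool; true; false; if_then_else_)
open import Data.Fin using (Fin; splitAt; toℕ)
open import Data.Sum using (inj₁; inj₂)
open import Relation.Nullary.Decidable using (⌊_⌋)

Matrix : ℕ → Set
Matrix n = Fin n → Fin n → ℕ

sumFin : (n : ℕ) → (Fin n → ℕ) → ℕ
sumFin zero    g = 0
sumFin (suc n) g = g Fin.zero + sumFin n (λ i → g (Fin.suc i))

_⊗_ : {n : ℕ} → Matrix n → Matrix n → Matrix n
_⊗_ {n} A B i j = sumFin n (λ l → A i l * B l j)

identity : {n : ℕ} → Matrix n
identity i j = if ⌊ i Data.Fin.≟ j ⌋ then 1 else 0

_^ᴹ_ : {n : ℕ} → Matrix n → ℕ → Matrix n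
A ^ᴹ zero  = identity
A ^ᴹ suc k = (A ^ᴹ k) ⊗ A

IsZeroOne : {n : ℕ} → Matrix n → Set
IsZeroOne {n} A = ∀ (i j : Fin n) → A i j ≤ 1

Γ : (n k : ℕ) → Matrix n → Set
Γ n k A = IsZeroOne A × IsZeroOne (A ^ᴹ k)
  where open import Data.Product using (_×_)

BVec : ℕ → Set
BVec n = Fin n → Bool

b2n : Bool → ℕ
b2n true  = 1
b2n false = 0

f : {n : ℕ} → BVec n → ℕ
f {n} x = sumFin n (λ i → b2n (x i))

data Part (k t s : ℕ) : Set where
  p1 : Fin k → Part k t s
  p2 : Fin t → Part k t s
  p3 : Fin s → Part k t s
  p4 : Part k t s

part : (k t s : ℕ) → Fin (k + t + s + 1) → Part k t s
part k t s i with splitAt (k + t + s) i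
... | inj₂ _ = p4
... | inj₁ i′ with splitAt (k + t) i′
...   | inj₂ c = p3 c
...   | inj₁ i″ with splitAt k i″
...     | inj₁ a = p1 a
...     | inj₂ b = p2 b

T : (t : ℕ) → Fin t → Fin t → ℕ
T t a b = if ⌊ toℕ a <? toℕ b ⌋ then 1 else 0

entry : (k t s : ℕ) (x₁ y₁ : BVec k) (x₂ y₂ : BVec t) (x₃ y₃ : BVec s) (α : Bool)
      → Part k t s → Part k t s → ℕ
entry k t s x₁ y₁ x₂ y₂ x₃ y₃ α (p1 a) (p1 _) = 0
entry k t s x₁ y₁ x₂ y₂ x₃ y₃ α (p1 a) (p2 _) = 1
entry k t s x₁ y₁ x₂ y₂ x₃ y₃ α (p1 a) (p3 _) = 1
entry k t s x₁ y₁ x₂ y₂ x₃ y₃ α (p1 a) p4     = b2n (x₁ a)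
entry k t s x₁ y₁ x₂ y₂ x₃ y₃ α (p2 a) (p1 _) = 0
entry k t s x₁ y₁ x₂ y₂ x₃ y₃ α (p2 a) (p2 b) = T t a b
entry k t s x₁ y₁ x₂ y₂ x₃ y₃ α (p2 a) (p3 _) = 1
entry k t s x₁ y₁ x₂ y₂ x₃ y₃ α (p2 a) p4     = b2n (x₂ a)
entry k t s x₁ y₁ x₂ y₂ x₃ y₃ α (p3 a) (p1 _) = 0
entry k t s x₁ y₁ x₂ y₂ x₃ y₃ α (p3 a) (p2 _) = 0
entry k t s x₁ y₁ x₂ y₂ x₃ y₃ α (p3 a) (p3 _) = 0
entry k t s x₁ y₁ x₂ y₂ x₃ y₃ α (p3 a) p4     = b2n (x₃ a)
entry k t s x₁ y₁ x₂ y₂ x₃ y₃ α p4 (p1 b)     = b2n (y₁ b)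
entry k t s x₁ y₁ x₂ y₂ x₃ y₃ α p4 (p2 b)     = b2n (y₂ b)
entry k t s x₁ y₁ x₂ y₂ x₃ y₃ α p4 (p3 b)     = b2n (y₃ b)
entry k t s x₁ y₁ x₂ y₂ x₃ y₃ α p4 p4         = b2n α

blockA : (k t s : ℕ) (x₁ y₁ : BVec k) (x₂ y₂ : BVec t) (x₃ y₃ : BVec s) (α : Bool)
       → Matrix (k + t + s + 1)
blockA k t s x₁ y₁ x₂ y₂ x₃ y₃ α i j =
  entry k t s x₁ y₁ x₂ y₂ x₃ y₃ α (part k t s i) (part k t s j)

-- the last index m (0-based: m - 1 = k + t + s)
lastIx : (k t s : ℕ) → Fin (k + t + s + 1)
lastIx k t s = Data.Fin.fromℕ< {k + t + s} (Data.Nat.Properties.m<m+n (k + t + s) (Data.Nat.s≤s Data.Nat.z≤n))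
  where import Data.Nat.Properties

module Submission where

-- Write K, T = T₀ < ⋯ < T_{t-1} and S for the first three index blocks and u for the
-- last index. Away from u, A is the strict order K < T₀ < ⋯ < T_{t-1} < S (levels
-- 0, 1, …, t + 1), so a walk of length n out of K that avoids u never sits below level n,
-- and from K to S there is exactly one such walk of length t + 1, the full chain. Each
-- conclusion is proved by exhibiting two walks of length t + 1 with the same ends,
-- contradicting A ∈ Γ(m, t + 1): an edge S → u extends, and an edge u → K precedes, the
-- t walks K ⇝ S of length t; a loop at u lets walks wait there, which forces the x-support
-- in K ∪ T and the y-support in T ∪ S to be antichains, too small for the count; and a
-- detour i → u → j with j ≤ i + 2 either reaches j together with the chain, or falls
-- behind it and rejoins it when both enter S.

open import Defs
open import Data.Bool using (Bool; true; false)
open import Data.Bool.Properties using (¬-not) renaming (_≟_ to _≟ᵇ_)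
open import Data.Empty using (⊥; ⊥-elim)
open import Data.Fin using (Fin; zero; suc; toℕ; fromℕ<; splitAt; _↑ˡ_; _↑ʳ_; _≟_)
open import Data.Fin.Properties
  using (toℕ<n; toℕ-fromℕ<; toℕ-↑ˡ; toℕ-↑ʳ; toℕ-injective; suc-injective; any?;
         splitAt-↑ˡ; splitAt-↑ʳ; splitAt⁻¹-↑ˡ; splitAt⁻¹-↑ʳ)
open import Data.Nat
  using (ℕ; zero; suc; _+_; _*_; _∸_; _≤_; _<_; _≥_; z≤n; s≤s; s≤s⁻¹; _≤?_; _<?_;
         _≤‴_; ≤‴-refl; ≤‴-step)
import Data.Fin.Properties as Fin
open import Data.Nat.Tactic.RingSolver using (solve)
open import Data.List using (_∷_; [])
open import Data.Nat.Properties hiding (_≟_; suc-injective)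
open import Data.Product using (_×_; _,_)
open import Data.Sum using (inj₁; inj₂)
open import Function using (_∘_)
open import Relation.Binary.Definitions using (tri<; tri≈; tri>)
open import Relation.Binary.PropositionalEquality
open import Relation.Nullary using (yes; no)

sumFin-≥ : ∀ n (g : Fin n → ℕ) (l : Fin n) → g l ≤ sumFin n g
sumFin-≥ (suc n) g zero    = m≤m+n _ _
sumFin-≥ (suc n) g (suc l) = ≤-trans (sumFin-≥ n (g ∘ suc) l) (m≤n+m _ _)

sumFin-≥₂ : ∀ n (g : Fin n → ℕ) {l l′ : Fin n} → l ≢ l′ → g l + g l′ ≤ sumFin n g
sumFin-≥₂ (suc n) g {zero}  {zero}   l≢l′ = ⊥-elim (l≢l′ refl)
sumFin-≥₂ (suc n) g {zero}  {suc l′} _    = +-monoʳ-≤ (g zero) (sumFin-≥ n (g ∘ suc) l′)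
sumFin-≥₂ (suc n) g {suc l} {zero}   _    =
  ≤-trans (≤-reflexive (+-comm (g (suc l)) (g zero))) (+-monoʳ-≤ (g zero) (sumFin-≥ n (g ∘ suc) l))
sumFin-≥₂ (suc n) g {suc l} {suc l′} l≢l′ =
  ≤-trans (sumFin-≥₂ n (g ∘ suc) (l≢l′ ∘ cong suc)) (m≤n+m _ _)

m*n≡m : ∀ m {n} → n ≡ 1 → m * n ≡ m
m*n≡m m refl = *-identityʳ m

module _ {n : ℕ} (A : Matrix n) where

  ^ᴹ-zero-diag : ∀ r → 1 ≤ (A ^ᴹ 0) r r
  ^ᴹ-zero-diag r with r ≟ r
  ... | yes _   = ≤-refl
  ... | no r≢r = ⊥-elim (r≢r refl)

  ^ᴹ-step : ∀ {m c r v w} → c ≤ (A ^ᴹ m) r v → A v w ≡ 1 → c ≤ (A ^ᴹ suc m) r w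
  ^ᴹ-step {m} {r = r} {v} {w} c≤ e =
    ≤-trans c≤ (≤-trans (≤-reflexive (sym (m*n≡m _ e))) (sumFin-≥ n (λ l → (A ^ᴹ m) r l * A l w) v))

  ^ᴹ-merge : ∀ {m c d r v v′ w} → v ≢ v′
           → c ≤ (A ^ᴹ m) r v → A v w ≡ 1 → d ≤ (A ^ᴹ m) r v′ → A v′ w ≡ 1
           → c + d ≤ (A ^ᴹ suc m) r w
  ^ᴹ-merge {m} {r = r} {v} {v′} {w} v≢v′ c≤ e d≤ e′ =
    ≤-trans (+-mono-≤ c≤ d≤)
      (≤-trans (≤-reflexive (sym (cong₂ _+_ (m*n≡m ((A ^ᴹ m) r v) e) (m*n≡m ((A ^ᴹ m) r v′) e′))))
               (sumFin-≥₂ n (λ l → (A ^ᴹ m) r l * A l w) v≢v′))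

b2n≤1 : ∀ b → b2n b ≤ 1
b2n≤1 true  = ≤-refl
b2n≤1 false = z≤n

b2n≢1 : ∀ {b} → b ≡ false → b2n b ≢ 1
b2n≢1 refl ()

bits-*≡0 : ∀ {a b} → a ≤ 1 → b ≤ 1 → (a ≡ 1 → b ≡ 1 → ⊥) → a * b ≡ 0
bits-*≡0 z≤n             _               _ = refl
bits-*≡0 (s≤s z≤n)       z≤n             _ = refl
bits-*≡0 (s≤s z≤n)       (s≤s z≤n)       h = ⊥-elim (h refl refl)

f-all-false : ∀ {n} (x : BVec n) → (∀ i → x i ≡ false) → f x ≡ 0
f-all-false {zero}  x _ = refl
f-all-false {suc n} x h rewrite h zero = f-all-false (x ∘ suc) (h ∘ suc)

f≤length : ∀ {n} (x : BVec n) → f x ≤ n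
f≤length {zero}  x = z≤n
f≤length {suc n} x = +-mono-≤ (b2n≤1 (x zero)) (f≤length (x ∘ suc))

AtMostOne : ∀ {n} → BVec n → Set
AtMostOne x = ∀ i j → x i ≡ true → x j ≡ true → i ≡ j

f≤1 : ∀ {n} (x : BVec n) → AtMostOne x → f x ≤ 1
f≤1 {zero}  x _ = z≤n
f≤1 {suc n} x unique with x zero in x₀
... | true  rewrite f-all-false (x ∘ suc) (λ i → ¬-not (λ xᵢ → Fin.0≢1+n (unique zero (suc i) x₀ xᵢ))) = ≤-refl
... | false = f≤1 (x ∘ suc) (λ i j xᵢ xⱼ → suc-injective (unique (suc i) (suc j) xᵢ xⱼ))

no-ordered-pair⇒AtMostOne : ∀ {n} (x : BVec n)
  → (∀ i j → toℕ i < toℕ j → x i ≡ true → x j ≡ true → ⊥) → AtMostOne x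
no-ordered-pair⇒AtMostOne x no-pair i j xᵢ xⱼ with <-cmp (toℕ i) (toℕ j)
... | tri< i<j _ _ = ⊥-elim (no-pair i j i<j xᵢ xⱼ)
... | tri≈ _ i≡j _ = toℕ-injective i≡j
... | tri> _ _ j<i = ⊥-elim (no-pair j i j<i xⱼ xᵢ)

f+f≤ : ∀ {m n} (x : BVec m) (y : BVec n) → 1 ≤ m
  → (∀ i j → x i ≡ true → y j ≡ true → ⊥) → AtMostOne y → f x + f y ≤ m
f+f≤ x y 1≤m disjoint y-unique with any? (λ j → y j ≟ᵇ true)
... | yes (j , yⱼ) rewrite f-all-false x (λ i → ¬-not (λ xᵢ → disjoint i j xᵢ yⱼ)) =
  ≤-trans (f≤1 y y-unique) 1≤m
... | no none rewrite f-all-false y (λ j → ¬-not (λ yⱼ → none (j , yⱼ))) =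
  ≤-trans (≤-reflexive (+-identityʳ _)) (f≤length x)

regroup : ∀ a b c d e g h → b ≡ 0 → e ≡ 0 → h ≡ 1
        → a + b + (c + d) + (e + g) + h ≡ suc (a + c + (d + g))
regroup a _ c d _ g _ refl refl refl = solve (a ∷ c ∷ d ∷ g ∷ [])

T-< : ∀ t {a b : Fin t} → toℕ a < toℕ b → T t a b ≡ 1
T-< t {a} {b} a<b with toℕ a <? toℕ b
... | yes _   = refl
... | no a≮b = ⊥-elim (a≮b a<b)

module Blocks (k t s : ℕ) where

  offset : Part k t s → ℕ
  offset (p1 a) = toℕ a
  offset (p2 b) = k + toℕ b
  offset (p3 c) = k + t + toℕ c
  offset p4     = k + t + s

  private
    toℕ-inj₁ : ∀ {m n} {i : Fin (m + n)} {j} → splitAt m i ≡ inj₁ j → toℕ i ≡ toℕ j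
    toℕ-inj₁ {n = n} {j = j} e = trans (cong toℕ (sym (splitAt⁻¹-↑ˡ e))) (toℕ-↑ˡ j n)

    toℕ-inj₂ : ∀ {m n} {i : Fin (m + n)} {j} → splitAt m i ≡ inj₂ j → toℕ i ≡ m + toℕ j
    toℕ-inj₂ {m} {j = j} e = trans (cong toℕ (sym (splitAt⁻¹-↑ʳ e))) (toℕ-↑ʳ m j)

  toℕ-part : ∀ i → toℕ i ≡ offset (part k t s i)
  toℕ-part i with splitAt (k + t + s) i in e₁
  ... | inj₂ zero = trans (toℕ-inj₂ e₁) (+-identityʳ _)
  ... | inj₁ i′ with splitAt (k + t) i′ in e₂
  ...   | inj₂ c = trans (toℕ-inj₁ e₁) (toℕ-inj₂ e₂)
  ...   | inj₁ i″ with splitAt k i″ in e₃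
  ...     | inj₁ a = trans (toℕ-inj₁ e₁) (trans (toℕ-inj₁ e₂) (toℕ-inj₁ e₃))
  ...     | inj₂ b = trans (toℕ-inj₁ e₁) (trans (toℕ-inj₁ e₂) (toℕ-inj₂ e₃))

  fromPart : Part k t s → Fin (k + t + s + 1)
  fromPart (p1 a) = ((a ↑ˡ t) ↑ˡ s) ↑ˡ 1
  fromPart (p2 b) = ((k ↑ʳ b) ↑ˡ s) ↑ˡ 1
  fromPart (p3 c) = ((k + t) ↑ʳ c) ↑ˡ 1
  fromPart p4     = (k + t + s) ↑ʳ zero

  part-fromPart : ∀ P → part k t s (fromPart P) ≡ P
  part-fromPart (p1 a)
    rewrite splitAt-↑ˡ (k + t + s) ((a ↑ˡ t) ↑ˡ s) 1 | splitAt-↑ˡ (k + t) (a ↑ˡ t) s | splitAt-↑ˡ k a t = refl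
  part-fromPart (p2 b)
    rewrite splitAt-↑ˡ (k + t + s) ((k ↑ʳ b) ↑ˡ s) 1 | splitAt-↑ˡ (k + t) (k ↑ʳ b) s | splitAt-↑ʳ k t b = refl
  part-fromPart (p3 c)
    rewrite splitAt-↑ˡ (k + t + s) ((k + t) ↑ʳ c) 1 | splitAt-↑ʳ (k + t) s c = refl
  part-fromPart p4
    rewrite splitAt-↑ʳ (k + t + s) 1 zero = refl

  part-lastIx : part k t s (lastIx k t s) ≡ p4
  part-lastIx = trans (cong (part k t s) lastIx≡) (part-fromPart p4)
    where
      lastIx≡ : lastIx k t s ≡ fromPart p4
      lastIx≡ = toℕ-injective (trans (toℕ-fromℕ< _) (sym (trans (toℕ-↑ʳ (k + t + s) zero) (+-identityʳ _))))

  -- u sits above S, so that `level Q ≤ suc t` just says Q ≠ p4.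
  level : Part k t s → ℕ
  level (p1 _) = 0
  level (p2 b) = suc (toℕ b)
  level (p3 _) = suc t
  level p4     = suc (suc t)

  level-p2≤ : ∀ b → level (p2 b) ≤ suc t
  level-p2≤ b = s≤s (<⇒≤ (toℕ<n b))

  p4≢ : ∀ {P} → level P ≤ suc t → p4 ≢ P
  p4≢ P≤ refl = 1+n≰n P≤

  tier : ∀ {ℓ} → 1 ≤ ℓ → ℓ ≤ t → Part k t s
  tier {suc b} _ b<t = p2 (fromℕ< b<t)

  level-tier : ∀ {ℓ} (1≤ℓ : 1 ≤ ℓ) (ℓ≤t : ℓ ≤ t) → level (tier 1≤ℓ ℓ≤t) ≡ ℓ
  level-tier {suc b} _ b<t = cong suc (toℕ-fromℕ< b<t)

  suc-offset≤ : ∀ P → level P ≤ t → suc (offset P) ≤ k + level P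
  suc-offset≤ (p1 a) _   = ≤-trans (toℕ<n a) (m≤m+n k 0)
  suc-offset≤ (p2 b) _   = ≤-reflexive (sym (+-suc k (toℕ b)))
  suc-offset≤ (p3 _) P≤ = ⊥-elim (1+n≰n P≤)
  suc-offset≤ p4     P≤ = ⊥-elim (1+n≰n (≤-trans (n≤1+n _) P≤))

  ≤suc-offset : ∀ Q → 1 ≤ level Q → level Q ≤ suc t → k + level Q ≤ suc (offset Q)
  ≤suc-offset (p2 b) _ _  = ≤-reflexive (+-suc k (toℕ b))
  ≤suc-offset (p3 c) _ _  = ≤-trans (≤-reflexive (+-suc k t)) (s≤s (m≤m+n (k + t) (toℕ c)))
  ≤suc-offset p4     _ Q≤ = ⊥-elim (1+n≰n Q≤)

  level-gap : ∀ P Q → level P ≤ t → 1 ≤ level Q → level Q ≤ suc t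
    → offset Q ≤ offset P + 2 → level Q ≤ level P + 2
  level-gap P Q P≤ 1≤Q Q≤ gap = +-cancelˡ-≤ k _ _ (begin
    k + level Q           ≤⟨ ≤suc-offset Q 1≤Q Q≤ ⟩
    suc (offset Q)        ≤⟨ s≤s gap ⟩
    suc (offset P) + 2    ≤⟨ +-monoˡ-≤ 2 (suc-offset≤ P P≤) ⟩
    k + level P + 2       ≡⟨ +-assoc k (level P) 2 ⟩
    k + (level P + 2)     ∎)
    where open ≤-Reasoning

module BlockMatrix (k t s : ℕ) (x₁ y₁ : BVec k) (x₂ y₂ : BVec t) (x₃ y₃ : BVec s) (α : Bool) where

  open Blocks k t s public

  A : Matrix (k + t + s + 1)
  A = blockA k t s x₁ y₁ x₂ y₂ x₃ y₃ α

  edge : Part k t s → Part k t s → ℕ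
  edge = entry k t s x₁ y₁ x₂ y₂ x₃ y₃ α

  edge-upward : ∀ P Q → level P < level Q → level Q ≤ suc t → edge P Q ≡ 1
  edge-upward (p1 _) (p2 _) _           _  = refl
  edge-upward (p1 _) (p3 _) _           _  = refl
  edge-upward (p2 a) (p2 b) (s≤s a<b)   _  = T-< t a<b
  edge-upward (p2 _) (p3 _) _           _  = refl
  edge-upward P      p4     _           Q≤ = ⊥-elim (1+n≰n Q≤)
  edge-upward (p3 _) (p2 b) (s≤s t<b)   _  = ⊥-elim (<⇒≱ (toℕ<n b) (≤-trans (n≤1+n t) t<b))
  edge-upward (p3 _) (p3 _) P<Q         _  = ⊥-elim (<-irrefl refl P<Q)
  edge-upward p4     Q      P<Q         Q≤ = ⊥-elim (<⇒≱ P<Q (≤-trans Q≤ (n≤1+n _)))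

  A-fromPart : ∀ P Q → A (fromPart P) (fromPart Q) ≡ edge P Q
  A-fromPart P Q = cong₂ edge (part-fromPart P) (part-fromPart Q)

  -- A record rather than the bare inequality, so that n, R and Q can be inferred.
  record Walks (c n : ℕ) (R Q : Part k t s) : Set where
    constructor walks
    field atLeast : c ≤ (A ^ᴹ n) (fromPart R) (fromPart Q)

  start : ∀ R → Walks 1 0 R R
  start R = walks (^ᴹ-zero-diag A (fromPart R))

  step : ∀ {m c R P} → Walks c m R P → ∀ Q → edge P Q ≡ 1 → Walks c (suc m) R Q
  step {m} {P = P} (walks w) Q e = walks (^ᴹ-step A {m} w (trans (A-fromPart P Q) e))

  merge : ∀ {m c d R V V′ Q} → V ≢ V′
        → Walks c m R V → edge V Q ≡ 1 → Walks d m R V′ → edge V′ Q ≡ 1 → Walks (c + d) (suc m) R Q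
  merge {m} {V = V} {V′} {Q} V≢V′ (walks w) e (walks w′) e′ =
    walks (^ᴹ-merge A {m} (V≢V′ ∘ fromPart-injective) w (trans (A-fromPart V Q) e) w′ (trans (A-fromPart V′ Q) e′))
    where
      fromPart-injective : fromPart V ≡ fromPart V′ → V ≡ V′
      fromPart-injective eq = trans (sym (part-fromPart V)) (trans (cong (part k t s) eq) (part-fromPart V′))

  castʷ : ∀ {c n n′ R Q} → n ≡ n′ → Walks c n R Q → Walks c n′ R Q
  castʷ refl w = w

  ≢-by-level : ∀ {V V′} → level V ≢ level V′ → V ≢ V′
  ≢-by-level lv e = lv (cong level e)

  module _ {ℓ} (1≤ℓ : 1 ≤ ℓ) (ℓ≤t : ℓ ≤ t) where

    level-tier≤ : level (tier 1≤ℓ ℓ≤t) ≤ suc t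
    level-tier≤ = ≤-trans (≤-reflexive (level-tier 1≤ℓ ℓ≤t)) (≤-trans ℓ≤t (n≤1+n t))

    edge-from-tier : ∀ Q → ℓ < level Q → level Q ≤ suc t → edge (tier 1≤ℓ ℓ≤t) Q ≡ 1
    edge-from-tier Q ℓ<Q = edge-upward _ Q (subst (_< level Q) (sym (level-tier 1≤ℓ ℓ≤t)) ℓ<Q)

  reach : ∀ n {m c R P Q} → 1 ≤ n → level P + n ≤ level Q → level Q ≤ suc t
        → Walks c m R P → Walks c (n + m) R Q
  reach (suc zero) {P = P} {Q} _ P+1≤Q Q≤ w =
    step w Q (edge-upward P Q (≤-trans (≤-reflexive (+-comm 1 (level P))) P+1≤Q) Q≤)
  reach (suc (suc n)) {P = P} {Q} _ P+n≤Q Q≤ w =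
    step (reach (suc n) (s≤s z≤n) (≤-reflexive (sym (level-tier 1≤ℓ ℓ≤t))) (level-tier≤ 1≤ℓ ℓ≤t) w) Q
         (edge-from-tier 1≤ℓ ℓ≤t Q ℓ<Q Q≤)
    where
      ℓ = level P + suc n
      ℓ<Q : ℓ < level Q
      ℓ<Q = <-≤-trans (+-monoʳ-< (level P) ≤-refl) P+n≤Q
      1≤ℓ : 1 ≤ ℓ
      1≤ℓ = ≤-trans (s≤s z≤n) (m≤n+m (suc n) (level P))
      ℓ≤t : ℓ ≤ t
      ℓ≤t = s≤s⁻¹ (≤-trans ℓ<Q Q≤)

  reach-from : ∀ n {R Q} → 1 ≤ n → level R + n ≤ level Q → level Q ≤ suc t → Walks 1 n R Q
  reach-from n {R} 1≤n R+n≤Q Q≤ = castʷ (+-identityʳ n) (reach n 1≤n R+n≤Q Q≤ (start R))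

  two-walks : ∀ n {m c R P Q} → 2 ≤ n → level P + n < level Q → level Q ≤ suc t
            → Walks c m R P → Walks (c + c) (n + m) R Q
  two-walks (suc zero) (s≤s ())
  two-walks (suc (suc n)) {P = P} {Q} _ ℓ′<Q Q≤ w =
    merge (≢-by-level λ e → <⇒≢ ℓ<ℓ′ (trans (sym (level-tier 1≤ℓ ℓ≤t)) (trans e (level-tier 1≤ℓ′ ℓ′≤t))))
      (reach (suc n) (s≤s z≤n) (≤-reflexive (sym (level-tier 1≤ℓ ℓ≤t))) (level-tier≤ 1≤ℓ ℓ≤t) w)
      (edge-from-tier 1≤ℓ ℓ≤t Q (<-trans ℓ<ℓ′ ℓ′<Q) Q≤)
      (reach (suc n) (s≤s z≤n) (≤-trans (<⇒≤ ℓ<ℓ′) (≤-reflexive (sym (level-tier 1≤ℓ′ ℓ′≤t)))) (level-tier≤ 1≤ℓ′ ℓ′≤t) w)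
      (edge-from-tier 1≤ℓ′ ℓ′≤t Q ℓ′<Q Q≤)
    where
      ℓ  = level P + suc n
      ℓ′ = level P + suc (suc n)
      ℓ<ℓ′ : ℓ < ℓ′
      ℓ<ℓ′ = +-monoʳ-< (level P) ≤-refl
      1≤ℓ : 1 ≤ ℓ
      1≤ℓ = ≤-trans (s≤s z≤n) (m≤n+m (suc n) (level P))
      1≤ℓ′ : 1 ≤ ℓ′
      1≤ℓ′ = ≤-trans (s≤s z≤n) (m≤n+m (suc (suc n)) (level P))
      ℓ′≤t : ℓ′ ≤ t
      ℓ′≤t = s≤s⁻¹ (≤-trans ℓ′<Q Q≤)
      ℓ≤t : ℓ ≤ t
      ℓ≤t = ≤-trans (<⇒≤ ℓ<ℓ′) ℓ′≤t

  loop : ∀ {m n c R U Q} → edge U U ≡ 1 → edge U Q ≡ 1 → m < n → Walks c m R U → Walks c n R Q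
  loop {c = c} {R} {U} {Q} UU UQ m<n = go (≤⇒≤‴ m<n)
    where
      go : ∀ {m n} → suc m ≤‴ n → Walks c m R U → Walks c n R Q
      go ≤‴-refl          w = step w Q UQ
      go (≤‴-step m+1<n) w = go m+1<n (step w U UU)

  module ZeroOnePower (1≤k : 1 ≤ k) (1≤s : 1 ≤ s) (3≤t : 3 ≤ t)
                      (power-zero-one : IsZeroOne (A ^ᴹ (t + 1))) where

    p₀ : Fin k
    p₀ = fromℕ< 1≤k

    p q : Part k t s
    p = p1 p₀
    q = p3 (fromℕ< 1≤s)

    1≤t : 1 ≤ t
    1≤t = ≤-trans (s≤s z≤n) 3≤t

    2≤t : 2 ≤ t
    2≤t = ≤-trans (n≤1+n 2) 3≤t

    no-two-walks : ∀ {n R Q} → n ≡ t + 1 → Walks 2 n R Q → ⊥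
    no-two-walks {R = R} {Q} refl (walks two) = 1+n≰n (≤-trans two (power-zero-one (fromPart R) (fromPart Q)))

    -- A walk to Q is on schedule when its length is level Q, and late when longer.
    no-two-walks-on-schedule : ∀ {n R} Q → 1 ≤ level Q → level Q ≤ suc t → level Q ≡ n → Walks 2 n R Q → ⊥
    no-two-walks-on-schedule (p3 _) _ _  refl two = no-two-walks (+-comm 1 t) two
    no-two-walks-on-schedule p4     _ Q≤ _    _   = 1+n≰n Q≤
    no-two-walks-on-schedule (p2 b) _ _  refl two =
      no-two-walks arrival (reach d {Q = q} (m<n⇒0<n∸m (toℕ<n b)) (≤-reflexive climb) ≤-refl two)
      where
        d = t ∸ toℕ b
        climb : level (p2 b) + d ≡ level q
        climb = cong suc (m+[n∸m]≡n (<⇒≤ (toℕ<n b)))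
        arrival : d + level (p2 b) ≡ t + 1
        arrival = trans (+-comm d _) (trans climb (+-comm 1 t))

    -- A late walk is kept late until time t; then it and the chain through T_{t-1} enter S
    -- from different vertices.
    no-late-walk : ∀ a {τ V} → level V < τ → τ ≤ t → Walks 1 τ (p1 a) V → ⊥
    no-late-walk a V<τ τ≤t w = no-two-walks (+-comm 1 t) (catch-up (≤⇒≤‴ τ≤t) V<τ w)
      where
        top = tier 1≤t ≤-refl
        level-top : level top ≡ t
        level-top = level-tier 1≤t ≤-refl

        catch-up : ∀ {τ V} → τ ≤‴ t → level V < τ → Walks 1 τ (p1 a) V → Walks 2 (suc t) (p1 a) q
        catch-up {V = V} ≤‴-refl V<t w =
          merge (≢-by-level λ e → <⇒≢ V<t (trans e level-top))
            w (edge-upward V q (≤-trans V<t (n≤1+n t)) ≤-refl)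
            (reach-from t 1≤t (≤-reflexive (sym level-top)) (level-tier≤ 1≤t ≤-refl))
            (edge-from-tier 1≤t ≤-refl q ≤-refl ≤-refl)
        catch-up {τ} {V} (≤‴-step τ<t) V<τ w =
          catch-up {V = tier 1≤ℓ ℓ≤t} τ<t (subst (_< suc τ) (sym (level-tier 1≤ℓ ℓ≤t)) (s≤s V<τ))
            (step w _ (edge-upward V _ (≤-reflexive (sym (level-tier 1≤ℓ ℓ≤t))) (level-tier≤ 1≤ℓ ℓ≤t)))
          where
            ℓ = suc (level V)
            1≤ℓ : 1 ≤ ℓ
            1≤ℓ = s≤s z≤n
            ℓ≤t : ℓ ≤ t
            ℓ≤t = ≤-trans V<τ (<⇒≤ (≤‴⇒≤ τ<t))

    -- The chain reaches Q at the same time, from a vertex of T instead of u.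
    no-on-schedule-walk-via-u : ∀ a {m Q} → 1 ≤ m → suc m ≡ level Q → level Q ≤ suc t
              → Walks 1 m (p1 a) p4 → edge p4 Q ≡ 1 → ⊥
    no-on-schedule-walk-via-u a {m} {Q} 1≤m m+1≡Q Q≤ w uQ =
      no-two-walks-on-schedule Q (≤-trans (s≤s z≤n) (≤-reflexive m+1≡Q)) Q≤ (sym m+1≡Q)
        (merge (p4≢ (level-tier≤ 1≤m m≤t)) w uQ
               (reach-from m 1≤m (≤-reflexive (sym (level-tier 1≤m m≤t))) (level-tier≤ 1≤m m≤t))
               (edge-from-tier 1≤m m≤t Q (≤-reflexive m+1≡Q) Q≤))
      where
        m≤t : m ≤ t
        m≤t = s≤s⁻¹ (≤-trans (≤-reflexive m+1≡Q) Q≤)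

    x₃≡false : ∀ c → x₃ c ≡ false
    x₃≡false c = ¬-not λ x₃c →
      no-two-walks (trans (cong suc (+-identityʳ t)) (+-comm 1 t))
        (step (two-walks t {Q = p3 c} 2≤t ≤-refl ≤-refl (start p)) p4 (cong b2n x₃c))

    y₁≡false : ∀ d → y₁ d ≡ false
    y₁≡false d = ¬-not λ y₁d →
      no-two-walks refl (two-walks t {Q = q} 2≤t ≤-refl ≤-refl (step (start p4) (p1 d) (cong b2n y₁d)))

    module _ (α≡true : α ≡ true) where

      u↺ : edge p4 p4 ≡ 1
      u↺ = cong b2n α≡true

      -- P → u and P → P′ → u both continue by waiting at u until time t + 1.
      into-u-antichain : ∀ P P′ → p4 ≢ P′ → edge P p4 ≡ 1 → edge P′ p4 ≡ 1 → edge P P′ ≡ 1 → ⊥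
      into-u-antichain P P′ p4≢P′ Pu P′u PP′ =
        no-two-walks refl
          (loop {Q = p4} u↺ u↺ (≤-trans 3≤t (m≤m+n t 1)) (merge p4≢P′ (step (start P) p4 Pu) u↺ (step (start P) P′ PP′) P′u))

      out-of-u-antichain : ∀ Q Q′ → p4 ≢ Q → edge p4 Q ≡ 1 → edge p4 Q′ ≡ 1 → edge Q Q′ ≡ 1 → ⊥
      out-of-u-antichain Q Q′ p4≢Q uQ uQ′ QQ′ =
        no-two-walks (+-comm 1 t)
          (merge p4≢Q (loop u↺ u↺ 1≤t (start p4)) uQ′ (loop u↺ uQ 1≤t (start p4)) QQ′)

      x-count : f x₁ + f x₂ ≤ k
      x-count = f+f≤ x₁ x₂ 1≤k
        (λ a b x₁a x₂b → into-u-antichain (p1 a) (p2 b) (λ ()) (cong b2n x₁a) (cong b2n x₂b) refl)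
        (no-ordered-pair⇒AtMostOne x₂ λ b b′ b<b′ x₂b x₂b′ →
          into-u-antichain (p2 b) (p2 b′) (λ ()) (cong b2n x₂b) (cong b2n x₂b′) (T-< t b<b′))

      y-count : f y₂ + f y₃ ≤ s
      y-count = subst (_≤ s) (+-comm (f y₃) (f y₂)) (f+f≤ y₃ y₂ 1≤s
        (λ c b y₃c y₂b → out-of-u-antichain (p2 b) (p3 c) (λ ()) (cong b2n y₂b) (cong b2n y₃c) refl)
        (no-ordered-pair⇒AtMostOne y₂ λ b b′ b<b′ y₂b y₂b′ →
          out-of-u-antichain (p2 b) (p2 b′) (λ ()) (cong b2n y₂b) (cong b2n y₂b′) (T-< t b<b′)))

    α≡false : s + k + 2 ≤ f x₁ + f y₁ + (f x₂ + f y₂) + (f x₃ + f y₃) + b2n α → α ≡ false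
    α≡false many = ¬-not λ α≡true → 1+n≰n (begin
      suc (suc (k + s))                                    ≡⟨ cong (2 +_) (+-comm k s) ⟩
      2 + (s + k)                                          ≡⟨ +-comm 2 (s + k) ⟩
      s + k + 2                                            ≤⟨ many ⟩
      f x₁ + f y₁ + (f x₂ + f y₂) + (f x₃ + f y₃) + b2n α ≡⟨ regroup (f x₁) (f y₁) (f x₂) (f y₂) (f x₃) (f y₃) (b2n α)
                                                                (f-all-false y₁ y₁≡false) (f-all-false x₃ x₃≡false)
                                                                (cong b2n α≡true) ⟩
      suc (f x₁ + f x₂ + (f y₂ + f y₃))                    ≤⟨ s≤s (+-mono-≤ (x-count α≡true) (y-count α≡true)) ⟩
      suc (k + s)                                          ∎)
      where open ≤-Reasoning

    -- The detour is on schedule when P can be reached at time level Q - 2: from K if P ∈ T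
    -- and level Q ≥ 3, from P itself if P ∈ K and level Q = 2. Otherwise it is late.
    no-short-detour : ∀ P Q → level P ≤ t → 1 ≤ level Q → level Q ≤ suc t → level Q ≤ level P + 2
                    → edge P p4 ≡ 1 → edge p4 Q ≡ 1 → ⊥
    no-short-detour (p1 a) Q _ _ Q≤ Q≤2 Pu uQ with level Q ≤? 1
    ... | yes Q≤1 = no-late-walk a (s≤s Q≤1) 2≤t (step (step (start (p1 a)) p4 Pu) Q uQ)
    ... | no  Q≰1 = no-on-schedule-walk-via-u a ≤-refl (≤-antisym (≰⇒> Q≰1) Q≤2) Q≤ (step (start (p1 a)) p4 Pu) uQ
    no-short-detour (p2 b) Q _ _ Q≤ Q≤b+3 Pu uQ with level Q ≤? 2
    ... | yes Q≤2 = no-late-walk p₀ (s≤s Q≤2) 3≤t (step (step (step (start p) (p2 b) refl) p4 Pu) Q uQ)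
    ... | no  Q≰2 = no-on-schedule-walk-via-u p₀ (s≤s z≤n) (m+[n∸m]≡n (<⇒≤ (≰⇒> Q≰2))) Q≤
                      (step (reach-from σ {Q = p2 b} (m<n⇒0<n∸m (≰⇒> Q≰2)) σ≤b+1 (level-p2≤ b)) p4 Pu) uQ
      where
        σ = level Q ∸ 2
        σ≤b+1 : σ ≤ level (p2 b)
        σ≤b+1 = ≤-trans (∸-monoˡ-≤ 2 Q≤b+3) (≤-reflexive (m+n∸n≡m _ 2))
    no-short-detour (p3 _) _ P≤ _ _ _ _ _ = 1+n≰n P≤
    no-short-detour p4     _ P≤ _ _ _ _ _ = 1+n≰n (≤-trans (n≤1+n _) P≤)

    module _ (α≡false : α ≡ false) where

      into-u-level : ∀ P → edge P p4 ≡ 1 → level P ≤ t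
      into-u-level (p1 _) _   = z≤n
      into-u-level (p2 b) _   = toℕ<n b
      into-u-level (p3 c) x₃c = ⊥-elim (b2n≢1 (x₃≡false c) x₃c)
      into-u-level p4     αu  = ⊥-elim (b2n≢1 α≡false αu)

      out-of-u-level : ∀ Q → edge p4 Q ≡ 1 → 1 ≤ level Q × level Q ≤ suc t
      out-of-u-level (p1 d) y₁d = ⊥-elim (b2n≢1 (y₁≡false d) y₁d)
      out-of-u-level (p2 b) _   = s≤s z≤n , level-p2≤ b
      out-of-u-level (p3 _) _   = s≤s z≤n , ≤-refl
      out-of-u-level p4     uα  = ⊥-elim (b2n≢1 α≡false uα)

      short-detour≡0 : IsZeroOne A → ∀ i j → toℕ j ≤ toℕ i + 2 → A i (lastIx k t s) * A (lastIx k t s) j ≡ 0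
      short-detour≡0 zero-one i j j≤i+2 =
        bits-*≡0 (zero-one i (lastIx k t s)) (zero-one (lastIx k t s) j) λ iu uj →
          let Pu  = trans (cong (edge P) (sym part-lastIx)) iu
              uQ  = trans (cong (λ U → edge U Q) (sym part-lastIx)) uj
              P≤t = into-u-level P Pu
              1≤Q , Q≤ = out-of-u-level Q uQ
          in no-short-detour P Q P≤t 1≤Q Q≤ (level-gap P Q P≤t 1≤Q Q≤ gap) Pu uQ
        where
          P = part k t s i
          Q = part k t s j
          gap : offset Q ≤ offset P + 2
          gap = subst₂ (λ a b → b ≤ a + 2) (toℕ-part i) (toℕ-part j) j≤i+2

lemma5 : (k t s : ℕ) → 1 ≤ s → 1 ≤ k → 3 ≤ t
    → (x₁ y₁ : BVec k) (x₂ y₂ : BVec t) (x₃ y₃ : BVec s) (α : Bool)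
    → Γ (k + t + s + 1) (t + 1) (blockA k t s x₁ y₁ x₂ y₂ x₃ y₃ α)
    → f x₁ + f y₁ + (f x₂ + f y₂) + (f x₃ + f y₃) + b2n α ≥ s + k + 2
    → (α ≡ false)
    × ((i : Fin k) → y₁ i ≡ false)
    × ((i : Fin s) → x₃ i ≡ false)
    × ((i j : Fin (k + t + s + 1)) → toℕ j ≤ toℕ i + 2
    → blockA k t s x₁ y₁ x₂ y₂ x₃ y₃ α i (lastIx k t s)
    * blockA k t s x₁ y₁ x₂ y₂ x₃ y₃ α (lastIx k t s) j ≡ 0)
lemma5 k t s 1≤s 1≤k 3≤t x₁ y₁ x₂ y₂ x₃ y₃ α (zero-one , power-zero-one) many =
  α≡false′ , y₁≡false , x₃≡false , short-detour≡0 α≡false′ zero-one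
  where
    open BlockMatrix k t s x₁ y₁ x₂ y₂ x₃ y₃ α
    open ZeroOnePower 1≤k 1≤s 3≤t power-zero-one
    α≡false′ = α≡false many
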